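{- For every integer $k\ge1$, the polynomial $P_k$ is primitive in $\mathbb{Z}[B,C]$, i.e. the greatest common divisor of its integer coefficients is $1$.
   Context: Let $B,C$ be independent indeterminates. $P_k$ denotes the $k$-th division polynomial $\psi_{k,E_T}$ of the Tate normal form $E_T: Y^2+(1-C)XY-BY = X^3-BX^2$ over $\mathbb{Z}[B,C]$, evaluated at the point $(0,0)$. Equivalently, $P_1=1$, $P_2=-B$, $P_3=-B^3$, $P_4=CB^5$, and for larger indices $P_{2l+1} = P_{l+2}P_l^3 - P_{l-1}P_{l+1}^3$ ($l\ge2$) and $P_{2l} = \frac{P_l}{P_2}\left(P_{l+2}P_{l-1}^2 - P_{l-2}P_{l+1}^2\right)$ ($l\ge3$). -}

module Defs where

open import Data.Nat using (ℕ; zero; suc; _∸_; _≤_; ⌊_/2⌋)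
open import Data.Nat.Divisibility using (_∣_)
open import Data.Bool using (Bool; true; false; if_then_else_)
open import Data.Integer as ℤ using (ℤ; ∣_∣)
open import Data.Nat using () renaming (_≡ᵇ_ to _=ℕ_)
open import Relation.Binary.PropositionalEquality using (_≡_)

-- Elements of ℤ[[B,C]] (containing ℤ[B,C]) as coefficient functions:
-- f i j = coefficient of B^i C^j.
Poly : Set
Poly = ℕ → ℕ → ℤ

sumTo : ℕ → (ℕ → ℤ) → ℤ
sumTo zero    g = g zero
sumTo (suc n) g = sumTo n g ℤ.+ g (suc n)

infixl 6 _⊕_ _⊖_
infixl 7 _⊛_

_⊕_ : Poly → Poly → Poly
(f ⊕ g) i j = f i j ℤ.+ g i j

_⊖_ : Poly → Poly → Poly
(f ⊖ g) i j = f i j ℤ.- g i j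

_⊛_ : Poly → Poly → Poly
(f ⊛ g) i j = sumTo i (λ a → sumTo j (λ b → f a b ℤ.* g (i ∸ a) (j ∸ b)))

mono : ℤ → ℕ → ℕ → Poly
mono c m n i j = if (i =ℕ m) then (if (j =ℕ n) then c else ℤ.0ℤ) else ℤ.0ℤ

zeroP : Poly
zeroP _ _ = ℤ.0ℤ

-- exact division by P₂ = -B (valid when the argument is divisible by B)
divByNegB : Poly → Poly
divByNegB f i j = ℤ.- f (suc i) j

odd : ℕ → Bool
odd zero = false
odd (suc n) with odd n
... | true  = false
... | false = true

-- P' fuel k ; the fuel is always sufficient when fuel ≥ k
-- (every recursive call is at an index strictly smaller than k).
P' : ℕ → ℕ → Poly
P' zero _ = zeroP
P' (suc fuel) 0 = zeroP
P' (suc fuel) 1 = mono (ℤ.+ 1) 0 0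
P' (suc fuel) 2 = mono (ℤ.- (ℤ.+ 1)) 1 0
P' (suc fuel) 3 = mono (ℤ.- (ℤ.+ 1)) 3 0
P' (suc fuel) 4 = mono (ℤ.+ 1) 5 1
P' (suc fuel) k@(suc (suc (suc (suc (suc _))))) =
  if odd k
  then
    (R (l + 2) ⊛ R l ⊛ R l ⊛ R l) ⊖ (R (l ∸ 1) ⊛ R (l + 1) ⊛ R (l + 1) ⊛ R (l + 1))
  else  -- k = 2l, l ≥ 3 : P_{2l} = (P_l / P_2)(P_{l+2}P_{l-1}^2 - P_{l-2}P_{l+1}^2)
    divByNegB (R l ⊛ ((R (l + 2) ⊛ R (l ∸ 1) ⊛ R (l ∸ 1)) ⊖ (R (l ∸ 2) ⊛ R (l + 1) ⊛ R (l + 1))))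
  where
  open Data.Nat using (_+_)
  l : ℕ
  l = ⌊ k /2⌋
  R : ℕ → Poly
  R = P' fuel

-- The division polynomials P_k = ψ_k(0,0) of the Tate normal form.
P : ℕ → Poly
P k = P' k k

IsPrimitive : Poly → Set
IsPrimitive f = (d : ℕ) → ((i j : ℕ) → d ∣ ∣ f i j ∣) → d ≡ 1

-- Order the monomials B^i C^j lexicographically by (i, j). For this order the lowest term of a
-- product is the product of the lowest terms, and the lowest term of f − g is that of f or of g
-- whenever these differ. Following the recursion, induction on k shows that the lowest term of P_k
-- is ±B^⌊k²/3⌋ C^(q(q+1)/2) with q = ⌊(k−1)/3⌋: writing k = 2l + 1 or k = 2l, in each residue class
-- of l modulo 3 one of the two competing products has the strictly smaller lowest term, and in the
-- even case the division by P₂ = −B lowers the B-exponent by one. A coefficient ±1 forces the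
-- content to be 1.
module Submission where

open import Data.Bool using (true; false)
open import Data.Bool.Properties using (T-≡)
open import Data.Fin using (Fin; toℕ)
open import Data.Fin.Patterns using (0F; 1F; 2F)
open import Data.Integer as ℤ using (ℤ; 0ℤ; ∣_∣)
import Data.Integer.Properties as ℤ
open import Data.List using (_∷_; [])
open import Data.Nat as ℕ
  using (ℕ; zero; suc; _+_; _*_; _∸_; _≤_; _<_; z≤n; s≤s; s≤s⁻¹; _≡ᵇ_)
open import Data.Nat.Divisibility using (_∣_; ∣1⇒≡1)
open import Data.Nat.DivMod using (DivMod; result; _divMod_)
open import Data.Nat.Properties
  using (_≟_; ≤-refl; ≤-trans; ≤-pred; m≤n⇒m≤1+n; n≤1+n; ≤∧≢⇒<; <⇒≢; m≤m+n; m<m+n; m∸n≤m;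
         m+[n∸m]≡n; m+n∸m≡n; +-suc; +-comm; +-monoʳ-≤; +-monoˡ-<; +-monoʳ-<;
         <-isStrictTotalOrder; ≡ᵇ⇒≡; ≡⇒≡ᵇ; n≡⌊n+n/2⌋; n≡⌈n+n/2⌉)
open import Data.Nat.Tactic.RingSolver using (solve-∀; solve)
open import Data.Product using (_×_; _,_; proj₁; proj₂)
open import Data.Product.Relation.Binary.Lex.Strict using (×-Lex; ×-isStrictTotalOrder)
open import Data.Sum using (_⊎_; inj₁; inj₂; [_,_])
open import Function using (id; _∘_)
open import Function.Bundles using (Equivalence)
open import Relation.Binary.Definitions using (tri<; tri≈; tri>)
open import Relation.Binary.PropositionalEquality
  using (_≡_; _≢_; refl; sym; trans; cong; cong₂; subst; module ≡-Reasoning)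
open import Relation.Binary.Structures using (IsStrictTotalOrder)
open import Relation.Nullary using (¬_; yes; no; contradiction)

open import Defs

infix 4 _<ₗ_ _≤ₗ_

_<ₗ_ : ℕ × ℕ → ℕ × ℕ → Set
_<ₗ_ = ×-Lex _≡_ _<_ _<_

_≤ₗ_ : ℕ × ℕ → ℕ × ℕ → Set
p ≤ₗ q = p <ₗ q ⊎ p ≡ q

open IsStrictTotalOrder (×-isStrictTotalOrder <-isStrictTotalOrder <-isStrictTotalOrder)
  using () renaming (trans to <ₗ-trans; irrefl to <ₗ-irrefl; asym to <ₗ-asym; compare to <ₗ-cmp)

<ₗ⇒≱ₗ : ∀ {p q} → p <ₗ q → ¬ q ≤ₗ p
<ₗ⇒≱ₗ p<q (inj₁ q<p) = <ₗ-asym p<q q<p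
<ₗ⇒≱ₗ p<q (inj₂ refl) = <ₗ-irrefl (refl , refl) p<q

+-monoˡ-<ₗ : ∀ {a b x y} c d → (a , b) <ₗ (x , y) → (a + c , b + d) <ₗ (x + c , y + d)
+-monoˡ-<ₗ c d (inj₁ a<x)         = inj₁ (+-monoˡ-< c a<x)
+-monoˡ-<ₗ c d (inj₂ (refl , b<y)) = inj₂ (refl , +-monoˡ-< d b<y)

+-monoʳ-<ₗ : ∀ {c d u v} a b → (c , d) <ₗ (u , v) → (a + c , b + d) <ₗ (a + u , b + v)
+-monoʳ-<ₗ a b (inj₁ c<u)         = inj₁ (+-monoʳ-< a c<u)
+-monoʳ-<ₗ a b (inj₂ (refl , d<v)) = inj₂ (refl , +-monoʳ-< b d<v)

+-mono-<ₗ-≤ₗ : ∀ {a b c d x y u v} → (a , b) <ₗ (x , y) → (c , d) ≤ₗ (u , v) →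
               (a + c , b + d) <ₗ (x + u , y + v)
+-mono-<ₗ-≤ₗ {c = c} {d} {x} {y} ab<xy (inj₁ cd<uv) =
  <ₗ-trans (+-monoˡ-<ₗ c d ab<xy) (+-monoʳ-<ₗ x y cd<uv)
+-mono-<ₗ-≤ₗ {c = c} {d} ab<xy (inj₂ refl) = +-monoˡ-<ₗ c d ab<xy

+-mono-≤ₗ : ∀ {a b c d x y u v} → (a , b) ≤ₗ (x , y) → (c , d) ≤ₗ (u , v) →
            (a + c , b + d) ≤ₗ (x + u , y + v)
+-mono-≤ₗ (inj₁ ab<xy) cd≤uv = inj₁ (+-mono-<ₗ-≤ₗ ab<xy cd≤uv)
+-mono-≤ₗ {a = a} {b} (inj₂ refl) (inj₁ cd<uv) = inj₁ (+-monoʳ-<ₗ a b cd<uv)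
+-mono-≤ₗ (inj₂ refl) (inj₂ refl) = inj₂ refl

sumTo-zero : ∀ n {g} → (∀ {x} → x ≤ n → g x ≡ 0ℤ) → sumTo n g ≡ 0ℤ
sumTo-zero zero    g≡0 = g≡0 z≤n
sumTo-zero (suc n) g≡0 = cong₂ ℤ._+_ (sumTo-zero n (g≡0 ∘ m≤n⇒m≤1+n)) (g≡0 ≤-refl)

sumTo-single : ∀ {n m g} → m ≤ n → (∀ {x} → x ≤ n → x ≢ m → g x ≡ 0ℤ) → sumTo n g ≡ g m
sumTo-single {zero} z≤n _ = refl
sumTo-single {suc n} {m} {g} m≤1+n others with m ≟ suc n
... | yes refl = trans (cong (ℤ._+ g m) (sumTo-zero n (λ x≤n → others (m≤n⇒m≤1+n x≤n) (<⇒≢ (s≤s x≤n)))))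
                       (ℤ.+-identityˡ (g m))
... | no m≢1+n = trans (cong₂ ℤ._+_ (sumTo-single (≤-pred (≤∧≢⇒< m≤1+n m≢1+n)) (others ∘ m≤n⇒m≤1+n))
                                    (others ≤-refl (m≢1+n ∘ sym)))
                       (ℤ.+-identityʳ (g m))

sumTo²-zero : ∀ m n {h : ℕ → ℕ → ℤ} → (∀ {x y} → x ≤ m → y ≤ n → h x y ≡ 0ℤ) →
              sumTo m (λ x → sumTo n (h x)) ≡ 0ℤ
sumTo²-zero m n h≡0 = sumTo-zero m (λ x≤m → sumTo-zero n (h≡0 x≤m))

sumTo²-single : ∀ {m n a b} {h : ℕ → ℕ → ℤ} → a ≤ m → b ≤ n →
                (∀ {x y} → x ≤ m → y ≤ n → (x , y) ≢ (a , b) → h x y ≡ 0ℤ) →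
                sumTo m (λ x → sumTo n (h x)) ≡ h a b
sumTo²-single a≤m b≤n others =
  trans (sumTo-single a≤m (λ x≤m x≢a → sumTo-zero _ (λ y≤n → others x≤m y≤n (x≢a ∘ cong proj₁))))
        (sumTo-single b≤n (λ y≤n y≢b → others a≤m y≤n (y≢b ∘ cong proj₂)))

≡ᵇ-refl : ∀ m → (m ≡ᵇ m) ≡ true
≡ᵇ-refl m = Equivalence.to T-≡ (≡⇒≡ᵇ m m refl)

≢⇒≡ᵇ≡false : ∀ {m n} → m ≢ n → (m ≡ᵇ n) ≡ false
≢⇒≡ᵇ≡false {m} {n} m≢n with m ≡ᵇ n in eq
... | false = refl
... | true  = contradiction (≡ᵇ⇒≡ m n (Equivalence.from T-≡ eq)) m≢n

<ₗ-or-≥ₗ : ∀ p q → p <ₗ q ⊎ q ≤ₗ p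
<ₗ-or-≥ₗ p q with <ₗ-cmp p q
... | tri< p<q _ _          = inj₁ p<q
... | tri≈ _ (p₁≡q₁ , p₂≡q₂) _ = inj₂ (inj₂ (sym (cong₂ _,_ p₁≡q₁ p₂≡q₂)))
... | tri> _ _ q<p          = inj₂ (inj₁ q<p)

record UnitLowestTerm (f : Poly) (a b : ℕ) : Set where
  field
    vanishes : ∀ {i j} → (i , j) <ₗ (a , b) → f i j ≡ 0ℤ
    unit     : ∣ f a b ∣ ≡ 1
open UnitLowestTerm

unitLowest⇒primitive : ∀ {f a b} → UnitLowestTerm f a b → IsPrimitive f
unitLowest⇒primitive {a = a} {b} F d d∣f = ∣1⇒≡1 (subst (d ∣_) (unit F) (d∣f a b))

unitLowest-mono : ∀ {c} a b → ∣ c ∣ ≡ 1 → UnitLowestTerm (mono c a b) a b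
unitLowest-mono {c} a b ∣c∣≡1 = record { vanishes = vanishes′ ; unit = unit′ }
  where
  vanishes′ : ∀ {i j} → (i , j) <ₗ (a , b) → mono c a b i j ≡ 0ℤ
  vanishes′ (inj₁ i<a) rewrite ≢⇒≡ᵇ≡false (<⇒≢ i<a) = refl
  vanishes′ (inj₂ (refl , j<b)) rewrite ≡ᵇ-refl a | ≢⇒≡ᵇ≡false (<⇒≢ j<b) = refl
  unit′ : ∣ mono c a b a b ∣ ≡ 1
  unit′ rewrite ≡ᵇ-refl a | ≡ᵇ-refl b = ∣c∣≡1

unitLowest-⊛ : ∀ {f g a b c d} → UnitLowestTerm f a b → UnitLowestTerm g c d →
               UnitLowestTerm (f ⊛ g) (a + c) (b + d)
unitLowest-⊛ {f} {g} {a} {b} {c} {d} F G = record { vanishes = vanishes′ ; unit = unit′ }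
  where
  recombine : ∀ {i j x y} → x ≤ i → y ≤ j → (x + (i ∸ x) , y + (j ∸ y)) ≡ (i , j)
  recombine x≤i y≤j = cong₂ _,_ (m+[n∸m]≡n x≤i) (m+[n∸m]≡n y≤j)

  term-support : ∀ i j x y →
    f x y ℤ.* g (i ∸ x) (j ∸ y) ≡ 0ℤ ⊎ ((a , b) ≤ₗ (x , y) × (c , d) ≤ₗ (i ∸ x , j ∸ y))
  term-support i j x y with <ₗ-or-≥ₗ (x , y) (a , b)
  ... | inj₁ xy<ab =
    inj₁ (trans (cong (ℤ._* g (i ∸ x) (j ∸ y)) (vanishes F xy<ab)) (ℤ.*-zeroˡ (g (i ∸ x) (j ∸ y))))
  ... | inj₂ ab≤xy with <ₗ-or-≥ₗ (i ∸ x , j ∸ y) (c , d)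
  ...   | inj₁ uv<cd = inj₁ (trans (cong (f x y ℤ.*_) (vanishes G uv<cd)) (ℤ.*-zeroʳ (f x y)))
  ...   | inj₂ cd≤uv = inj₂ (ab≤xy , cd≤uv)

  vanishes′ : ∀ {i j} → (i , j) <ₗ (a + c , b + d) → (f ⊛ g) i j ≡ 0ℤ
  vanishes′ {i} {j} ij<ac,bd = sumTo²-zero i j λ {x} {y} x≤i y≤j →
    [ id , (λ { (ab≤xy , cd≤uv) → contradiction
                  (subst ((a + c , b + d) ≤ₗ_) (recombine x≤i y≤j) (+-mono-≤ₗ ab≤xy cd≤uv))
                  (<ₗ⇒≱ₗ ij<ac,bd) }) ] (term-support i j x y)

  off-lowest : ∀ {x y} → x ≤ a + c → y ≤ b + d → (x , y) ≢ (a , b) →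
               f x y ℤ.* g (a + c ∸ x) (b + d ∸ y) ≡ 0ℤ
  off-lowest {x} {y} x≤ y≤ xy≢ab with term-support (a + c) (b + d) x y
  ... | inj₁ term≡0                = term≡0
  ... | inj₂ (inj₂ refl , _)       = contradiction refl xy≢ab
  ... | inj₂ (inj₁ ab<xy , cd≤uv) = contradiction
          (subst ((a + c , b + d) <ₗ_) (recombine x≤ y≤) (+-mono-<ₗ-≤ₗ ab<xy cd≤uv))
          (<ₗ-irrefl (refl , refl))

  unit′ : ∣ (f ⊛ g) (a + c) (b + d) ∣ ≡ 1
  unit′ = begin
    ∣ (f ⊛ g) (a + c) (b + d) ∣            ≡⟨ cong ∣_∣ (sumTo²-single (m≤m+n a c) (m≤m+n b d) off-lowest) ⟩
    ∣ f a b ℤ.* g (a + c ∸ a) (b + d ∸ b) ∣ ≡⟨ cong₂ (λ u v → ∣ f a b ℤ.* g u v ∣) (m+n∸m≡n a c) (m+n∸m≡n b d) ⟩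
    ∣ f a b ℤ.* g c d ∣                     ≡⟨ ℤ.abs-* (f a b) (g c d) ⟩
    ∣ f a b ∣ ℕ.* ∣ g c d ∣                 ≡⟨ cong₂ ℕ._*_ (unit F) (unit G) ⟩
    1                                       ∎
    where open ≡-Reasoning

unitLowest-cong : ∀ {f a b a′ b′} → UnitLowestTerm f a b → a ≡ a′ → b ≡ b′ → UnitLowestTerm f a′ b′
unitLowest-cong F refl refl = F

unitLowest-⊛² : ∀ {f g a b c d} → UnitLowestTerm f a b → UnitLowestTerm g c d →
                UnitLowestTerm (f ⊛ g ⊛ g) (a + c + c) (b + d + d)
unitLowest-⊛² F G = unitLowest-⊛ (unitLowest-⊛ F G) G

unitLowest-⊛³ : ∀ {f g a b c d} → UnitLowestTerm f a b → UnitLowestTerm g c d →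
                UnitLowestTerm (f ⊛ g ⊛ g ⊛ g) (a + c + c + c) (b + d + d + d)
unitLowest-⊛³ F G = unitLowest-⊛ (unitLowest-⊛² F G) G

unitLowest-⊖ˡ : ∀ {f g a b c d} → UnitLowestTerm f a b → UnitLowestTerm g c d →
                (a , b) <ₗ (c , d) → UnitLowestTerm (f ⊖ g) a b
unitLowest-⊖ˡ {f} {a = a} {b} F G ab<cd = record
  { vanishes = λ ij<ab → cong₂ ℤ._-_ (vanishes F ij<ab) (vanishes G (<ₗ-trans ij<ab ab<cd))
  ; unit     = trans (cong (λ z → ∣ f a b ℤ.- z ∣) (vanishes G ab<cd))
                     (trans (cong ∣_∣ (ℤ.+-identityʳ (f a b))) (unit F))
  }

unitLowest-⊖ʳ : ∀ {f g a b c d} → UnitLowestTerm f a b → UnitLowestTerm g c d →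
                (c , d) <ₗ (a , b) → UnitLowestTerm (f ⊖ g) c d
unitLowest-⊖ʳ {g = g} {c = c} {d} F G cd<ab = record
  { vanishes = λ ij<cd → cong₂ ℤ._-_ (vanishes F (<ₗ-trans ij<cd cd<ab)) (vanishes G ij<cd)
  ; unit     = trans (cong (λ z → ∣ z ℤ.- g c d ∣) (vanishes F cd<ab))
                     (trans (cong ∣_∣ (ℤ.+-identityˡ (ℤ.- g c d))) (trans (ℤ.∣-i∣≡∣i∣ (g c d)) (unit G)))
  }

-- In the recursion the two competing lowest terms either differ by exactly one in the B-exponent
-- or share it.
unitLowest-⊖ˡ-fst : ∀ {f g a b c d} → UnitLowestTerm f a b → UnitLowestTerm g c d →
                    suc a ≡ c → UnitLowestTerm (f ⊖ g) a b
unitLowest-⊖ˡ-fst F G refl = unitLowest-⊖ˡ F G (inj₁ ≤-refl)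

unitLowest-⊖ˡ-snd : ∀ {f g a b c d} → UnitLowestTerm f a b → UnitLowestTerm g c d →
                    a ≡ c → b < d → UnitLowestTerm (f ⊖ g) a b
unitLowest-⊖ˡ-snd F G refl b<d = unitLowest-⊖ˡ F G (inj₂ (refl , b<d))

unitLowest-⊖ʳ-fst : ∀ {f g a b c d} → UnitLowestTerm f a b → UnitLowestTerm g c d →
                    suc c ≡ a → UnitLowestTerm (f ⊖ g) c d
unitLowest-⊖ʳ-fst F G refl = unitLowest-⊖ʳ F G (inj₁ ≤-refl)

unitLowest-⊖ʳ-snd : ∀ {f g a b c d} → UnitLowestTerm f a b → UnitLowestTerm g c d →
                    c ≡ a → d < b → UnitLowestTerm (f ⊖ g) c d
unitLowest-⊖ʳ-snd F G refl d<b = unitLowest-⊖ʳ F G (inj₂ (refl , d<b))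

unitLowest-divByNegB : ∀ {f a b} → UnitLowestTerm f (suc a) b → UnitLowestTerm (divByNegB f) a b
unitLowest-divByNegB {f} {a} {b} F = record
  { vanishes = λ ij<ab → cong ℤ.-_ (vanishes F (+-monoʳ-<ₗ 1 0 ij<ab))
  ; unit     = trans (ℤ.∣-i∣≡∣i∣ (f (suc a) b)) (unit F)
  }

tri : ℕ → ℕ
tri zero    = 0
tri (suc m) = tri m + suc m

tri-< : ∀ m → tri m < tri (suc m)
tri-< m = m<m+n (tri m) (s≤s z≤n)

tri-2m+1 : ∀ m → tri (suc m) + tri m + tri m + tri m ≡ tri (suc (m * 2))
tri-2m+1 zero    = refl
tri-2m+1 (suc m) = trans (regroup m (tri m))
  (cong (λ s → s + suc (suc (m * 2)) + suc (suc (suc (m * 2)))) (tri-2m+1 m))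
  where
  regroup : ∀ m t → t + suc m + suc (suc m) + (t + suc m) + (t + suc m) + (t + suc m)
                    ≡ t + suc m + t + t + t + suc (suc (m * 2)) + suc (suc (suc (m * 2)))
  regroup = solve-∀

tri-2m+2 : ∀ m → tri m + tri (suc m) + tri (suc m) + tri (suc m) ≡ tri (suc m * 2)
tri-2m+2 m = trans (regroup m (tri m)) (cong (_+ suc (suc (m * 2))) (tri-2m+1 m))
  where
  regroup : ∀ m t → t + (t + suc m) + (t + suc m) + (t + suc m) ≡ t + suc m + t + t + t + suc (suc (m * 2))
  regroup = solve-∀

swap-< : ∀ {a b} → a < b → b + a + a < a + b + b
swap-< {a} {b} a<b = subst (_< a + b + b) (cong (_+ a) (+-comm a b)) (+-monoʳ-< (a + b) a<b)

oddStep : (ℕ → Poly) → ℕ → Poly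
oddStep R l = (R (l + 2) ⊛ R l ⊛ R l ⊛ R l) ⊖ (R (l ∸ 1) ⊛ R (l + 1) ⊛ R (l + 1) ⊛ R (l + 1))

evenStep : (ℕ → Poly) → ℕ → Poly
evenStep R l = divByNegB (R l ⊛ ((R (l + 2) ⊛ R (l ∸ 1) ⊛ R (l ∸ 1)) ⊖ (R (l ∸ 2) ⊛ R (l + 1) ⊛ R (l + 1))))

odd-double : ∀ n → odd (n + n) ≡ false
odd-double zero    = refl
odd-double (suc n) rewrite +-suc n n | odd-double n = refl

P'-odd : ∀ fuel l → 2 ≤ l → P' (suc fuel) (suc (l + l)) ≡ oddStep (P' fuel) l
P'-odd fuel (suc (suc l)) (s≤s (s≤s z≤n))
  rewrite +-suc l (suc l) | +-suc l l | odd-double l | sym (n≡⌈n+n/2⌉ l) = refl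

P'-even : ∀ fuel l → 3 ≤ l → P' (suc fuel) (l + l) ≡ evenStep (P' fuel) l
P'-even fuel (suc (suc (suc l))) (s≤s (s≤s (s≤s z≤n)))
  rewrite +-suc l (suc (suc l)) | +-suc l (suc l) | +-suc l l | odd-double l | sym (n≡⌊n+n/2⌋ l) = refl

-- For n = ρ + 3q with ρ = r + 1 ∈ {1,2,3} the lowest term of P_n is ±B^⌊n²/3⌋ C^tri(q),
-- where ⌊n²/3⌋ = q (3q + 2ρ) + ⌊ρ²/3⌋ and ⌊ρ²/3⌋ = tri r.
LowestTerm : Poly → ℕ → Fin 3 → Set
LowestTerm f q r = UnitLowestTerm f (q * (q * 3 + 2 * suc (toℕ r)) + tri (toℕ r)) (tri q)

-- A record, so that q and r can be inferred from LowestAt f q r: LowestTerm f q r mentions r only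
-- through toℕ r.
record LowestAt (f : Poly) (q : ℕ) (r : Fin 3) : Set where
  constructor lowestAt
  field lowestTerm : LowestTerm f q r
open LowestAt

-- P' fuel n agrees with P n only for n ≤ fuel.
LowestUpTo : ℕ → ℕ → Set
LowestUpTo fuel m = ∀ {n} q r → n ≡ suc (toℕ r) + q * 3 → n ≤ m → LowestAt (P' fuel n) q r

lowestUpTo-mono : ∀ {fuel m m′} → m ≤ m′ → LowestUpTo fuel m′ → LowestUpTo fuel m
lowestUpTo-mono m≤m′ IH q r n≡ n≤m = IH q r n≡ (≤-trans n≤m m≤m′)

-- The hypotheses for l ∸ 1 and l ∸ 2 are stated without truncated subtraction.
module Neighbours {fuel l : ℕ} (IH : LowestUpTo fuel (l + 2)) where

  P[l+2] : ∀ q r → l + 2 ≡ suc (toℕ r) + q * 3 → LowestTerm (P' fuel (l + 2)) q r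
  P[l+2] q r eq = IH q r eq ≤-refl .lowestTerm

  P[l+1] : ∀ q r → l + 1 ≡ suc (toℕ r) + q * 3 → LowestTerm (P' fuel (l + 1)) q r
  P[l+1] q r eq = IH q r eq (+-monoʳ-≤ l (n≤1+n 1)) .lowestTerm

  P[l] : ∀ q r → l ≡ suc (toℕ r) + q * 3 → LowestTerm (P' fuel l) q r
  P[l] q r eq = IH q r eq (m≤m+n l 2) .lowestTerm

  P[l-1] : ∀ q r → l ≡ 1 + (suc (toℕ r) + q * 3) → LowestTerm (P' fuel (l ∸ 1)) q r
  P[l-1] q r eq = IH q r (cong (_∸ 1) eq) (≤-trans (m∸n≤m l 1) (m≤m+n l 2)) .lowestTerm

  P[l-2] : ∀ q r → l ≡ 2 + (suc (toℕ r) + q * 3) → LowestTerm (P' fuel (l ∸ 2)) q r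
  P[l-2] q r eq = IH q r (cong (_∸ 2) eq) (≤-trans (m∸n≤m l 2) (m≤m+n l 2)) .lowestTerm

lowest-oddStep-3+3p : ∀ fuel p → LowestUpTo fuel (3 + 3 * p + 2) →
                      LowestAt (oddStep (P' fuel) (3 + 3 * p)) (suc p * 2) 0F
lowest-oddStep-3+3p fuel p IH = lowestAt (unitLowest-cong
  (unitLowest-⊖ʳ-fst
    (unitLowest-⊛³ (P[l+2] (suc p) 1F (solve (p ∷ []))) (P[l] p 2F (solve (p ∷ []))))
    (unitLowest-⊛³ (P[l-1] p 1F (solve (p ∷ []))) (P[l+1] (suc p) 0F (solve (p ∷ []))))
    (solve (p ∷ [])))
  (solve (p ∷ [])) (tri-2m+2 p))
  where open Neighbours {fuel} {3 + 3 * p} IH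

lowest-evenStep-3+3p : ∀ fuel p → LowestUpTo fuel (3 + 3 * p + 2) →
                       LowestAt (evenStep (P' fuel) (3 + 3 * p)) (suc (p * 2)) 2F
lowest-evenStep-3+3p fuel p IH = lowestAt (unitLowest-divByNegB (unitLowest-cong
  (unitLowest-⊛ (P[l] p 2F (solve (p ∷ [])))
    (unitLowest-⊖ˡ-snd
      (unitLowest-⊛² (P[l+2] (suc p) 1F (solve (p ∷ []))) (P[l-1] p 1F (solve (p ∷ []))))
      (unitLowest-⊛² (P[l-2] p 0F (solve (p ∷ []))) (P[l+1] (suc p) 0F (solve (p ∷ []))))
      (solve (p ∷ [])) (swap-< (tri-< p))))
  (solve (p ∷ [])) (trans (+-comm (tri p) _) (tri-2m+1 p))))
  where open Neighbours {fuel} {3 + 3 * p} IH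

lowest-oddStep-4+3p : ∀ fuel p → LowestUpTo fuel (4 + 3 * p + 2) →
                      LowestAt (oddStep (P' fuel) (4 + 3 * p)) (suc p * 2) 2F
lowest-oddStep-4+3p fuel p IH = lowestAt (unitLowest-cong
  (unitLowest-⊖ʳ-snd
    (unitLowest-⊛³ (P[l+2] (suc p) 2F (solve (p ∷ []))) (P[l] (suc p) 0F (solve (p ∷ []))))
    (unitLowest-⊛³ (P[l-1] p 2F (solve (p ∷ []))) (P[l+1] (suc p) 1F (solve (p ∷ []))))
    (solve (p ∷ [])) (+-monoˡ-< _ (+-monoˡ-< _ (+-monoˡ-< _ (tri-< p)))))
  (solve (p ∷ [])) (tri-2m+2 p))
  where open Neighbours {fuel} {4 + 3 * p} IH

lowest-evenStep-4+3p : ∀ fuel p → LowestUpTo fuel (4 + 3 * p + 2) →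
                       LowestAt (evenStep (P' fuel) (4 + 3 * p)) (suc p * 2) 1F
lowest-evenStep-4+3p fuel p IH = lowestAt (unitLowest-divByNegB (unitLowest-cong
  (unitLowest-⊛ (P[l] (suc p) 0F (solve (p ∷ [])))
    (unitLowest-⊖ʳ-fst
      (unitLowest-⊛² (P[l+2] (suc p) 2F (solve (p ∷ []))) (P[l-1] p 2F (solve (p ∷ []))))
      (unitLowest-⊛² (P[l-2] p 1F (solve (p ∷ []))) (P[l+1] (suc p) 1F (solve (p ∷ []))))
      (solve (p ∷ []))))
  (solve (p ∷ [])) (trans (+-comm (tri (suc p)) _) (tri-2m+2 p))))
  where open Neighbours {fuel} {4 + 3 * p} IH

lowest-oddStep-2+3p : ∀ fuel p → LowestUpTo fuel (2 + 3 * p + 2) →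
                      LowestAt (oddStep (P' fuel) (2 + 3 * p)) (suc (p * 2)) 1F
lowest-oddStep-2+3p fuel p IH = lowestAt (unitLowest-cong
  (unitLowest-⊖ˡ-fst
    (unitLowest-⊛³ (P[l+2] (suc p) 0F (solve (p ∷ []))) (P[l] p 1F (solve (p ∷ []))))
    (unitLowest-⊛³ (P[l-1] p 0F (solve (p ∷ []))) (P[l+1] p 2F (solve (p ∷ []))))
    (solve (p ∷ [])))
  (solve (p ∷ [])) (tri-2m+1 p))
  where open Neighbours {fuel} {2 + 3 * p} IH

lowest-evenStep-5+3p : ∀ fuel p → LowestUpTo fuel (5 + 3 * p + 2) →
                       LowestAt (evenStep (P' fuel) (5 + 3 * p)) (suc (suc p * 2)) 0F
lowest-evenStep-5+3p fuel p IH = lowestAt (unitLowest-divByNegB (unitLowest-cong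
  (unitLowest-⊛ (P[l] (suc p) 1F (solve (p ∷ [])))
    (unitLowest-⊖ˡ-fst
      (unitLowest-⊛² (P[l+2] (suc (suc p)) 0F (solve (p ∷ []))) (P[l-1] (suc p) 0F (solve (p ∷ []))))
      (unitLowest-⊛² (P[l-2] p 2F (solve (p ∷ []))) (P[l+1] (suc p) 2F (solve (p ∷ []))))
      (solve (p ∷ []))))
  (solve (p ∷ [])) (trans (+-comm (tri (suc p)) _) (tri-2m+1 (suc p)))))
  where open Neighbours {fuel} {5 + 3 * p} IH

lowest-via-oddStep : ∀ {fuel n q r} l → 2 ≤ l → n ≤ suc fuel → n ≡ suc (l + l) →
                     LowestUpTo fuel fuel →
                     (LowestUpTo fuel (l + 2) → LowestAt (oddStep (P' fuel) l) q r) →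
                     LowestAt (P' (suc fuel) n) q r
lowest-via-oddStep {fuel} {q = q} {r} l 2≤l n≤1+fuel refl IH step =
  subst (λ f → LowestAt f q r) (sym (P'-odd fuel l 2≤l))
        (step (lowestUpTo-mono {fuel} (≤-trans (+-monoʳ-≤ l 2≤l) (s≤s⁻¹ n≤1+fuel)) IH))

lowest-via-evenStep : ∀ {fuel n q r} l → 3 ≤ l → n ≤ suc fuel → n ≡ l + l →
                      LowestUpTo fuel fuel →
                      (LowestUpTo fuel (l + 2) → LowestAt (evenStep (P' fuel) l) q r) →
                      LowestAt (P' (suc fuel) n) q r
lowest-via-evenStep {fuel} {q = q} {r} l 3≤l n≤1+fuel refl IH step =
  subst (λ f → LowestAt f q r) (sym (P'-even fuel l 3≤l))
        (step (lowestUpTo-mono {fuel} l+2≤fuel IH))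
  where
  l+2≤fuel : l + 2 ≤ fuel
  l+2≤fuel = s≤s⁻¹ (subst (_≤ suc fuel) (+-suc l 2) (≤-trans (+-monoʳ-≤ l 3≤l) n≤1+fuel))

lowest-step : ∀ {fuel q} → LowestUpTo fuel fuel → DivMod q 2 → (r : Fin 3) →
              suc (toℕ r) + q * 3 ≤ suc fuel → LowestAt (P' (suc fuel) (suc (toℕ r) + q * 3)) q r
lowest-step _ (result zero 0F refl) 0F _ = lowestAt (unitLowest-mono 0 0 refl)
lowest-step _ (result zero 0F refl) 1F _ = lowestAt (unitLowest-mono 1 0 refl)
lowest-step _ (result zero 0F refl) 2F _ = lowestAt (unitLowest-mono 3 0 refl)
lowest-step {fuel} IH (result (suc p) 0F refl) 0F n≤ =
  lowest-via-oddStep  (3 + 3 * p) (s≤s (s≤s z≤n)) n≤ (solve (p ∷ [])) IH (lowest-oddStep-3+3p fuel p)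
lowest-step {fuel} IH (result (suc p) 0F refl) 1F n≤ =
  lowest-via-evenStep (4 + 3 * p) (s≤s (s≤s (s≤s z≤n))) n≤ (solve (p ∷ [])) IH (lowest-evenStep-4+3p fuel p)
lowest-step {fuel} IH (result (suc p) 0F refl) 2F n≤ =
  lowest-via-oddStep  (4 + 3 * p) (s≤s (s≤s z≤n)) n≤ (solve (p ∷ [])) IH (lowest-oddStep-4+3p fuel p)
lowest-step _ (result zero 1F refl) 0F _ = lowestAt (unitLowest-mono 5 1 refl)
lowest-step {fuel} IH (result (suc p) 1F refl) 0F n≤ =
  lowest-via-evenStep (5 + 3 * p) (s≤s (s≤s (s≤s z≤n))) n≤ (solve (p ∷ [])) IH (lowest-evenStep-5+3p fuel p)
lowest-step {fuel} IH (result p       1F refl) 1F n≤ =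
  lowest-via-oddStep  (2 + 3 * p) (s≤s (s≤s z≤n)) n≤ (solve (p ∷ [])) IH (lowest-oddStep-2+3p fuel p)
lowest-step {fuel} IH (result p       1F refl) 2F n≤ =
  lowest-via-evenStep (3 + 3 * p) (s≤s (s≤s (s≤s z≤n))) n≤ (solve (p ∷ [])) IH (lowest-evenStep-3+3p fuel p)

lowestUpTo-suc : ∀ {fuel} → LowestUpTo fuel fuel → LowestUpTo (suc fuel) (suc fuel)
lowestUpTo-suc IH q r refl n≤ = lowest-step IH (q divMod 2) r n≤

lowestUpTo : ∀ fuel → LowestUpTo fuel fuel
lowestUpTo zero       _ _ refl ()
lowestUpTo (suc fuel) = lowestUpTo-suc (lowestUpTo fuel)

propositionA1 : (k : ℕ) → 1 ≤ k → IsPrimitive (P k)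
propositionA1 (suc k) _ with k divMod 3
... | result q r k≡r+3q =
  unitLowest⇒primitive (lowestUpTo (suc k) q r (cong suc k≡r+3q) ≤-refl .lowestTerm)
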